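{- Let $\mathcal{I}$ be an ideal on $\mathbb{N}$, and let $t(\mathcal{I})=\{A\subseteq\mathbb{N}: A+k\in\mathcal{I}\text{ for every }k\in\mathbb{Z}\}$. Then (1) $t(\mathcal{I})$ is a translation invariant ideal; (2) if $\mathcal{I}$ does not have the Baire property, then $t(\mathcal{I})$ does not have the Baire property.
   Context: For $A\subseteq\mathbb{N}$ and $k\in\mathbb{Z}$, $A+k$ denotes $\{a+k:a\in A\}\cap\mathbb{N}$. An ideal on $\mathbb{N}$ is a family $\mathcal{I}\subseteq\mathcal{P}(\mathbb{N})$ closed under finite unions and subsets, containing all finite subsets of $\mathbb{N}$, with $\mathbb{N}\notin\mathcal{I}$; it is translation invariant if $A+k\in\mathcal{I}$ for all $A\in\mathcal{I}$, $k\in\mathbb{Z}$. Subsets of $\mathbb{N}$ are identified with their characteristic functions, so $\mathcal{P}(\mathbb{N})$ carries the topology of the Cantor space $\{0,1\}^{\mathbb{N}}$; an ideal has the Baire property if it has the Baire property as a subset of this space. -}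

module Defs where

open import Data.Nat using (ℕ; _+_; _∸_; _<_; _≤_; _<ᵇ_; suc)
open import Data.Integer using (ℤ; +_; -[1+_])
open import Data.Bool using (Bool; true; false; if_then_else_; _∨_)
open import Data.Product using (Σ; _×_; ∃)
open import Data.Sum using (_⊎_)
open import Relation.Nullary using (¬_)
open import Relation.Binary.PropositionalEquality using (_≡_)

-- A subset of ℕ, identified with its characteristic function (a point of Cantor space).
SubsetN : Set
SubsetN = ℕ → Bool

Family : Set₁
Family = SubsetN → Set

_⊆ₛ_ : SubsetN → SubsetN → Set
A ⊆ₛ B = ∀ n → A n ≡ true → B n ≡ true

_∪ₛ_ : SubsetN → SubsetN → SubsetN
(A ∪ₛ B) n = A n ∨ B n

Whole : SubsetN
Whole _ = true

FiniteSet : SubsetN → Set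
FiniteSet A = ∃ λ N → ∀ m → N ≤ m → A m ≡ false

record IsIdeal (I : Family) : Set where
  field
    finite-mem : ∀ A → FiniteSet A → I A
    union-mem  : ∀ A B → I A → I B → I (A ∪ₛ B)
    subset-mem : ∀ A B → A ⊆ₛ B → I B → I A
    whole-not  : ¬ I Whole

-- A + k = {a + k : a ∈ A} ∩ ℕ :  m ∈ A + k  iff  m - k ∈ ℕ and m - k ∈ A.
shift : ℤ → SubsetN → SubsetN
shift (+ j)      A m = if m <ᵇ j then false else A (m ∸ j)
shift -[1+ j ]   A m = A (m + suc j)

TranslationInvariant : Family → Set
TranslationInvariant I = ∀ A (k : ℤ) → I A → I (shift k A)

t : Family → Family
t I A = ∀ (k : ℤ) → I (shift k A)

Agree : ℕ → SubsetN → SubsetN → Set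
Agree n x y = ∀ i → i < n → x i ≡ y i

IsOpen : Family → Set
IsOpen U = ∀ x → U x → ∃ λ n → ∀ y → Agree n x y → U y

NowhereDense : Family → Set
NowhereDense N = ∀ x n → Σ SubsetN λ y → Σ ℕ λ m →
  Agree n x y × n ≤ m × (∀ z → Agree m y z → ¬ N z)

Meager : Family → Set₁
Meager M = Σ (ℕ → Family) λ N → (∀ k → NowhereDense (N k)) × (∀ x → M x → ∃ λ k → N k x)

SymDiff : Family → Family → Family
SymDiff A B x = (A x × ¬ B x) ⊎ (B x × ¬ A x)

HasBaireProperty : Family → Set₁
HasBaireProperty A = Σ Family λ U → IsOpen U × Meager (SymDiff A U)

{-# OPTIONS --safe #-}
module Submission where

-- t(I) is an ideal because translates of finite sets are finite, and translation invariant
-- because a translate of a translate is contained in a single translate. Now let t(I) differ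
-- from an open set U by a meager set. If U contains a cylinder [x↾n], a generic y in it and
-- its complement beyond n both belong to t(I); with [0, n) they cover ℕ, a contradiction.
-- If U is empty then t(I) is meager, and so is I: for a suitably generic Y and A ∈ I the set
-- of i ∈ Y with A ⊇ [i/2, 2i) lies in t(I), which forces A to omit a point from each interval
-- of a fixed sequence, from some index on.

open import Defs
open import Data.Bool using (Bool; true; false; if_then_else_; not; _∧_; _∨_)
open import Data.Bool.Properties using (not-involutive; ∨-zeroʳ; ∧-identityʳ)
open import Data.Empty using (⊥)
open import Data.Integer as ℤ using (+_; -[1+_]; _⊖_)
import Data.Integer.Properties as ℤ
open import Data.Nat
  using (ℕ; zero; suc; _+_; _∸_; _<_; _≤_; _<ᵇ_; _<?_; _≟_; z≤n; s≤s; z<s; _≤′_; ≤′-refl; ≤′-step; ⌊_/2⌋)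
open import Data.Nat.Properties
open import Data.Product using (Σ; ∃; _×_; _,_; proj₁; proj₂)
open import Data.Sum using (_⊎_; inj₁; inj₂; [_,_])
open import Function using (_∘_)
open import Relation.Binary.PropositionalEquality
  using (_≡_; refl; sym; trans; cong; cong₂; subst; module ≡-Reasoning)
open import Relation.Nullary using (¬_; yes; no; ¬¬-excluded-middle)
open import Relation.Nullary.Negation using (contradiction)

private
  variable
    m n i j : ℕ
    A B : SubsetN

<⇒<ᵇ≡true : m < n → (m <ᵇ n) ≡ true
<⇒<ᵇ≡true {m} {n} m<n with m <ᵇ n | <⇒<ᵇ m<n
... | true | _ = refl

≥⇒<ᵇ≡false : n ≤ m → (m <ᵇ n) ≡ false
≥⇒<ᵇ≡false {n} {m} n≤m with m <ᵇ n | <ᵇ⇒< m n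
... | false | _    = refl
... | true  | m<n = contradiction n≤m (<⇒≱ (m<n _))

shift+-< : ∀ A → m < j → shift (+ j) A m ≡ false
shift+-< {m} {j} A m<j = cong (λ b → if b then false else A (m ∸ j)) (<⇒<ᵇ≡true m<j)

shift+-≥ : ∀ A → j ≤ m → shift (+ j) A m ≡ A (m ∸ j)
shift+-≥ {j} {m} A j≤m = cong (λ b → if b then false else A (m ∸ j)) (≥⇒<ᵇ≡false j≤m)

shift-true⇒ : ∀ k A m → shift k A m ≡ true → ∃ λ a → A a ≡ true × + m ≡ + a ℤ.+ k
shift-true⇒ (+ j) A m m∈ with m <? j
... | yes m<j = contradiction (trans (sym (shift+-< A m<j)) m∈) λ ()
... | no m≮j = m ∸ j , trans (sym (shift+-≥ A j≤m)) m∈ ,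
                     trans (cong +_ (sym (m∸n+n≡m j≤m))) (ℤ.pos-+ (m ∸ j) j)
  where j≤m = ≮⇒≥ m≮j
shift-true⇒ -[1+ j ] A m m∈ =
  m + suc j , m∈ , sym (trans (ℤ.⊖-≥ (m≤n+m (suc j) m)) (cong +_ (m+n∸n≡m m (suc j))))

true⇒shift-true : ∀ k A {a m} → A a ≡ true → + m ≡ + a ℤ.+ k → shift k A m ≡ true
true⇒shift-true (+ j) A {a} {m} a∈ +m≡+a+j =
  trans (shift+-≥ A (subst (j ≤_) (sym m≡a+j) (m≤n+m j a)))
        (subst (λ x → A x ≡ true) (sym (trans (cong (_∸ j) m≡a+j) (m+n∸n≡m a j))) a∈)
  where
  m≡a+j : m ≡ a + j
  m≡a+j = ℤ.+-injective (trans +m≡+a+j (sym (ℤ.pos-+ a j)))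
true⇒shift-true -[1+ j ] A {a} {m} a∈ m≡a-j = subst (λ x → A x ≡ true) (ℤ.+-injective a≡m+j) a∈
  where
  open ≡-Reasoning
  a≡m+j : + a ≡ + (m + suc j)
  a≡m+j = begin
    + a                                    ≡⟨ trans (cong (ℤ._+_ (+ a)) (ℤ.n⊖n≡0 (suc j))) (ℤ.+-identityʳ (+ a)) ⟨
    + a ℤ.+ (suc j ⊖ suc j)                ≡⟨ ℤ.+-assoc (+ a) -[1+ j ] (+ suc j) ⟨
    + a ℤ.+ -[1+ j ] ℤ.+ + suc j           ≡⟨ cong (ℤ._+ + suc j) m≡a-j ⟨
    + m ℤ.+ + suc j                        ≡⟨ ℤ.pos-+ m (suc j) ⟨
    + (m + suc j)                          ∎

shift-mono : ∀ k → A ⊆ₛ B → shift k A ⊆ₛ shift k B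
shift-mono {A} {B} k A⊆B m m∈ with shift-true⇒ k A m m∈
... | a , a∈ , eq = true⇒shift-true k B (A⊆B a a∈) eq

shift-∪ : ∀ k A B m → shift k (A ∪ₛ B) m ≡ (shift k A ∪ₛ shift k B) m
shift-∪ (+ j) A B m with m <ᵇ j
... | true  = refl
... | false = refl
shift-∪ -[1+ j ] A B m = refl

shift-shift : ∀ k l A → shift l (shift k A) ⊆ₛ shift (k ℤ.+ l) A
shift-shift k l A m m∈ with shift-true⇒ l (shift k A) m m∈
... | b , b∈ , m≡b+l with shift-true⇒ k A b b∈
... | a , a∈ , b≡a+k = true⇒shift-true (k ℤ.+ l) A a∈
  (trans m≡b+l (trans (cong (ℤ._+ l) b≡a+k) (ℤ.+-assoc (+ a) k l)))

shift-finite : ∀ k → FiniteSet A → FiniteSet (shift k A)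
shift-finite {A} (+ j) (N , A-fin) = N + j , λ m N+j≤m →
  let j≤m = ≤-trans (m≤n+m j N) N+j≤m in
  trans (shift+-≥ A j≤m) (A-fin (m ∸ j) (subst (_≤ m ∸ j) (m+n∸n≡m N j) (∸-monoˡ-≤ j N+j≤m)))
shift-finite -[1+ j ] (N , A-fin) = N , λ m N≤m → A-fin (m + suc j) (≤-trans N≤m (m≤m+n m (suc j)))

t-isIdeal : ∀ {I} → IsIdeal I → IsIdeal (t I)
t-isIdeal {I} I-ideal = record
  { finite-mem = λ A A-fin k → finite-mem _ (shift-finite k A-fin)
  ; union-mem  = λ A B A∈ B∈ k →
      subset-mem _ _ (λ m m∈ → trans (sym (shift-∪ k A B m)) m∈) (union-mem _ _ (A∈ k) (B∈ k))
  ; subset-mem = λ A B A⊆B B∈ k → subset-mem _ _ (shift-mono k A⊆B) (B∈ k)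
  ; whole-not  = λ Whole∈ → whole-not (Whole∈ (+ 0))
  }
  where open IsIdeal I-ideal

t-translationInvariant : ∀ {I} → IsIdeal I → TranslationInvariant (t I)
t-translationInvariant I-ideal A k A∈ l = subset-mem _ _ (shift-shift k l A) (A∈ (k ℤ.+ l))
  where open IsIdeal I-ideal

record Cylinder : Set where
  constructor [_↾_]
  field
    stem   : SubsetN
    length : ℕ
open Cylinder

_∈ᶜ_ : SubsetN → Cylinder → Set
z ∈ᶜ [ x ↾ n ] = Agree n x z

_⊆ᶜ_ : Cylinder → Cylinder → Set
b ⊆ᶜ a = length a ≤ length b × stem b ∈ᶜ a

_⊂ᶜ_ : Cylinder → Cylinder → Set
b ⊂ᶜ a = length a < length b × stem b ∈ᶜ a

⊂ᶜ⇒⊆ᶜ : ∀ {a b} → b ⊂ᶜ a → b ⊆ᶜ a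
⊂ᶜ⇒⊆ᶜ (a<b , b∈a) = <⇒≤ a<b , b∈a

∈ᶜ-⊆ᶜ : ∀ {z a b} → z ∈ᶜ b → b ⊆ᶜ a → z ∈ᶜ a
∈ᶜ-⊆ᶜ z∈b (a≤b , b∈a) i i<a = trans (b∈a i i<a) (z∈b i (<-≤-trans i<a a≤b))

⊆ᶜ-refl : ∀ {a} → a ⊆ᶜ a
⊆ᶜ-refl = ≤-refl , λ _ _ → refl

⊆ᶜ-trans : ∀ {a b c} → c ⊆ᶜ b → b ⊆ᶜ a → c ⊆ᶜ a
⊆ᶜ-trans (b≤c , c∈b) b⊆a@(a≤b , _) = ≤-trans a≤b b≤c , ∈ᶜ-⊆ᶜ c∈b b⊆a

Avoids : Family → Cylinder → Set
Avoids N c = ∀ z → z ∈ᶜ c → ¬ N z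

Dense : (Cylinder → Set) → Set
Dense G = ∀ a → Σ Cylinder λ b → b ⊂ᶜ a × G b

Hereditary : (Cylinder → Set) → Set
Hereditary G = ∀ {a b} → b ⊆ᶜ a → G a → G b

avoids-hereditary : ∀ {N} → Hereditary (Avoids N)
avoids-hereditary b⊆a avoid z z∈b = avoid z (∈ᶜ-⊆ᶜ z∈b b⊆a)

nowhereDense⇒dense-avoids : ∀ {N} → NowhereDense N → Dense (Avoids N)
nowhereDense⇒dense-avoids N-nd [ x ↾ n ] with N-nd x n
... | y , m , y∈x↾n , n≤m , avoid =
  [ y ↾ suc m ] , (s≤s n≤m , y∈x↾n) , λ z z∈ → avoid z (λ i i<m → z∈ i (m<n⇒m<1+n i<m))

dense-avoids⇒nowhereDense : ∀ {N} → Dense (Avoids N) → NowhereDense N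
dense-avoids⇒nowhereDense dense x n with dense [ x ↾ n ]
... | [ y ↾ m ] , (n<m , y∈x↾n) , avoid = y , m , y∈x↾n , <⇒≤ n<m , avoid

dense-∩ : ∀ {G H} → Hereditary G → Dense G → Dense H → Dense (λ c → G c × H c)
dense-∩ G-her G-dense H-dense a with G-dense a
... | b , b⊂a , Gb with H-dense b
... | c , c⊂b@(b<c , c∈b) , Hc =
  c , (<-trans (proj₁ b⊂a) b<c , ∈ᶜ-⊆ᶜ c∈b (⊂ᶜ⇒⊆ᶜ b⊂a)) , G-her (⊂ᶜ⇒⊆ᶜ c⊂b) Gb , Hc

nowhereDense-∪ : ∀ {M N} → NowhereDense M → NowhereDense N → NowhereDense (λ z → M z ⊎ N z)
nowhereDense-∪ M-nd N-nd = dense-avoids⇒nowhereDense λ a →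
  let b , b⊂a , avoid-M , avoid-N =
        dense-∩ avoids-hereditary (nowhereDense⇒dense-avoids M-nd) (nowhereDense⇒dense-avoids N-nd) a
  in b , b⊂a , λ { z z∈b (inj₁ Mz) → avoid-M z z∈b Mz ; z z∈b (inj₂ Nz) → avoid-N z z∈b Nz }

module Fusion (R : ℕ → Cylinder → Cylinder → Set)
              (step : ∀ j a → Σ Cylinder λ b → b ⊂ᶜ a × R j a b)
              (start : Cylinder) where

  chain : ℕ → Cylinder
  chain zero    = start
  chain (suc j) = proj₁ (step j (chain j))

  chain-⊂ᶜ : ∀ j → chain (suc j) ⊂ᶜ chain j
  chain-⊂ᶜ j = proj₁ (proj₂ (step j (chain j)))

  chain-R : ∀ j → R j (chain j) (chain (suc j))
  chain-R j = proj₂ (proj₂ (step j (chain j)))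

  chain-⊆ᶜ : i ≤ j → chain j ⊆ᶜ chain i
  chain-⊆ᶜ = go ∘ ≤⇒≤′
    where
    go : i ≤′ j → chain j ⊆ᶜ chain i
    go ≤′-refl        = ⊆ᶜ-refl
    go (≤′-step i≤′j) = ⊆ᶜ-trans (⊂ᶜ⇒⊆ᶜ (chain-⊂ᶜ _)) (go i≤′j)

  length-chain-≥ : ∀ j → j ≤ length (chain j)
  length-chain-≥ zero    = z≤n
  length-chain-≥ (suc j) = ≤-<-trans (length-chain-≥ j) (proj₁ (chain-⊂ᶜ j))

  limit : SubsetN
  limit i = stem (chain (suc i)) i

  limit-∈ : ∀ j → limit ∈ᶜ chain j
  limit-∈ j i i<len with i <? j
  ... | yes i<j = sym (proj₂ (chain-⊆ᶜ i<j) i (length-chain-≥ (suc i)))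
  ... | no i≮j  = proj₂ (chain-⊆ᶜ (m≤n⇒m≤1+n (≮⇒≥ i≮j))) i i<len

baire-category : ∀ {N : ℕ → Family} → (∀ j → NowhereDense (N j)) →
                 ∀ a → Σ SubsetN λ x → x ∈ᶜ a × (∀ j → ¬ N j x)
baire-category {N} N-nd a = limit , limit-∈ 0 , λ j → chain-R j limit (limit-∈ (suc j))
  where open Fusion (λ j _ → Avoids (N j)) (λ j → nowhereDense⇒dense-avoids (N-nd j)) a

splice : ℕ → SubsetN → SubsetN → SubsetN
splice n x y i = if i <ᵇ n then x i else y i

splice-< : ∀ x y → i < n → splice n x y i ≡ x i
splice-< {i} {n} x y i<n = cong (λ b → if b then x i else y i) (<⇒<ᵇ≡true i<n)

splice-≥ : ∀ x y → n ≤ i → splice n x y i ≡ y i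
splice-≥ {n} {i} x y n≤i = cong (λ b → if b then x i else y i) (≥⇒<ᵇ≡false n≤i)

flipFrom : ℕ → SubsetN → SubsetN
flipFrom n x = splice n x (not ∘ x)

flipFrom-involutive : ∀ n x i → flipFrom n (flipFrom n x) i ≡ x i
flipFrom-involutive n x i with i <ᵇ n
... | true  = refl
... | false = not-involutive (x i)

flipFrom-agree : ∀ n {m x y} → Agree m x y → Agree m (flipFrom n x) (flipFrom n y)
flipFrom-agree n {x = x} {y} x≈y i i<m = cong (λ b → if i <ᵇ n then b else not b) (x≈y i i<m)

below : ℕ → SubsetN
below n i = i <ᵇ n

below-finite : ∀ n → FiniteSet (below n)
below-finite n = n , λ _ → ≥⇒<ᵇ≡false

whole-⊆-flipFrom : ∀ n x → Whole ⊆ₛ ((x ∪ₛ flipFrom n x) ∪ₛ below n)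
whole-⊆-flipFrom n x i _ = excluded (x i) (i <ᵇ n)
  where
  excluded : ∀ b c → (b ∨ (if c then b else not b)) ∨ c ≡ true
  excluded true  _     = refl
  excluded false true  = refl
  excluded false false = refl

nowhereDense-preimage : ∀ {N} (f : SubsetN → SubsetN) → (∀ x i → f (f x) i ≡ x i) →
                        (∀ m {x y} → Agree m x y → Agree m (f x) (f y)) →
                        NowhereDense N → NowhereDense (N ∘ f)
nowhereDense-preimage f f-involutive f-agree N-nd x n with N-nd (f x) n
... | y , m , fx≈y , n≤m , avoid =
  f y , m , back fx≈y , n≤m , λ z fy≈z → avoid (f z) (back fy≈z)
  where
  back : ∀ {k u v} → Agree k (f u) v → Agree k u (f v)
  back {u = u} fu≈v i i<k = trans (sym (f-involutive u i)) (f-agree _ fu≈v i i<k)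

meager-⊆ : ∀ {M M′ : Family} → (∀ x → M x → M′ x) → Meager M′ → Meager M
meager-⊆ M⊆M′ (N , N-nd , cover) = N , N-nd , λ x Mx → cover x (M⊆M′ x Mx)

ideal-not-comeager-in-cylinder : ∀ {J} → IsIdeal J → ∀ a → ¬ Meager (λ z → z ∈ᶜ a × ¬ J z)
ideal-not-comeager-in-cylinder {J} J-ideal [ x ↾ n ] (N , N-nd , cover)
  with baire-category (λ j → nowhereDense-∪ (N-nd j)
         (nowhereDense-preimage (flipFrom n) (flipFrom-involutive n) (λ _ → flipFrom-agree n) (N-nd j)))
         [ x ↾ n ]
... | y , x≈y , avoid =
  ¬¬J y x≈y (λ j → avoid j ∘ inj₁) λ Jy → ¬¬J (flipFrom n y) x≈flipped (λ j → avoid j ∘ inj₂) λ Jflipped →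
    whole-not (subset-mem _ _ (whole-⊆-flipFrom n y)
      (union-mem _ _ (union-mem _ _ Jy Jflipped) (finite-mem _ (below-finite n))))
  where
  open IsIdeal J-ideal
  ¬¬J : ∀ z → z ∈ᶜ [ x ↾ n ] → (∀ j → ¬ N j z) → ¬ ¬ J z
  ¬¬J z z∈ avoid-z ¬Jz = let j , Njz = cover z (z∈ , ¬Jz) in avoid-z j Njz
  x≈flipped : flipFrom n y ∈ᶜ [ x ↾ n ]
  x≈flipped i i<n = trans (x≈y i i<n) (sym (splice-< y (not ∘ y) i<n))

dense-∀≤ : ∀ {G : ℕ → Cylinder → Set} → (∀ k → Hereditary (G k)) → (∀ k → Dense (G k)) →
           ∀ j → Dense (λ c → ∀ k → k ≤ j → G k c)
dense-∀≤ G-her G-dense zero a =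
  let b , b⊂a , Gb = G-dense 0 a in b , b⊂a , λ { _ z≤n → Gb }
dense-∀≤ G-her G-dense (suc j) a =
  let b , b⊂a , G≤j , Gj+1 = dense-∩ (λ b⊆a G≤ k k≤j → G-her k b⊆a (G≤ k k≤j))
                                     (dense-∀≤ G-her G-dense j) (G-dense (suc j)) a
  in b , b⊂a , λ k k≤j+1 → [ G≤j k ∘ m<1+n⇒m≤n , (λ { refl → Gj+1 }) ] (m≤n⇒m<n∨m≡n k≤j+1)

AgreeOn : ℕ → ℕ → SubsetN → SubsetN → Set
AgreeOn p q x y = ∀ i → p ≤ i → i < q → x i ≡ y i

agreeOn-⊆ᶜ : ∀ {p a b z} → b ⊆ᶜ a → AgreeOn p (length b) (stem b) z → AgreeOn p (length a) (stem a) z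
agreeOn-⊆ᶜ (a≤b , b∈a) b≈z i p≤i i<a = trans (b∈a i i<a) (b≈z i p≤i (<-≤-trans i<a a≤b))

AvoidsAbove : ℕ → Family → Cylinder → Set
AvoidsAbove p N b = ∀ z → AgreeOn p (length b) (stem b) z → ¬ N z

avoidsAbove-hereditary : ∀ {p N} → Hereditary (AvoidsAbove p N)
avoidsAbove-hereditary b⊆a avoid z b≈z = avoid z (agreeOn-⊆ᶜ b⊆a b≈z)

_[_≔_] : SubsetN → ℕ → Bool → SubsetN
(u [ r ≔ v ]) i with i ≟ r
... | yes _ = v
... | no  _ = u i

-- Induction on the number r of free coordinates below p: freeing coordinate r intersects
-- the two dense hereditary conditions with that coordinate fixed to false and to true.
avoidsAbove-dense : ∀ {N} → NowhereDense N → ∀ p → Dense (AvoidsAbove p N)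
avoidsAbove-dense {N} N-nd p a =
  let b , b⊂a , avoid = avoidsFixing-dense p (λ _ → false) a
  in b , b⊂a , λ z b≈z → avoid z (λ i p≤i i<p → contradiction i<p (≤⇒≯ p≤i)) b≈z
  where
  AvoidsFixing : ℕ → SubsetN → Cylinder → Set
  AvoidsFixing r u b = ∀ z → AgreeOn r p u z → AgreeOn p (length b) (stem b) z → ¬ N z

  avoidsFixing-hereditary : ∀ r u → Hereditary (AvoidsFixing r u)
  avoidsFixing-hereditary r u b⊆a avoid z u≈z b≈z = avoid z u≈z (agreeOn-⊆ᶜ b⊆a b≈z)

  agreeOn-update : ∀ {r u z} → AgreeOn (suc r) p u z → AgreeOn r p (u [ r ≔ z r ]) z
  agreeOn-update {r} u≈z i r≤i i<p with i ≟ r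
  ... | yes refl = refl
  ... | no  i≢r  = u≈z i (≤∧≢⇒< r≤i (i≢r ∘ sym)) i<p

  avoidsFixing-dense : ∀ r u → Dense (AvoidsFixing r u)
  avoidsFixing-dense zero u [ x ↾ n ]
    with nowhereDense⇒dense-avoids N-nd [ splice p u x ↾ n + p ]
  ... | [ w ↾ m ] , (n+p<m , ux≈w) , avoid =
    [ splice p x w ↾ m ] , (≤-<-trans (m≤m+n n p) n+p<m , x≈xw) , λ z u≈z xw≈z → avoid z (w≈z u≈z xw≈z)
    where
    x≈xw : Agree n x (splice p x w)
    x≈xw i i<n with i <? p
    ... | yes i<p = sym (splice-< x w i<p)
    ... | no  i≮p = let p≤i = ≮⇒≥ i≮p in
      trans (sym (splice-≥ u x p≤i)) (trans (ux≈w i (<-≤-trans i<n (m≤m+n n p))) (sym (splice-≥ x w p≤i)))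
    w≈z : ∀ {z} → AgreeOn 0 p u z → AgreeOn p m (splice p x w) z → Agree m w z
    w≈z u≈z xw≈z i i<m with i <? p
    ... | yes i<p = trans (sym (ux≈w i (<-≤-trans i<p (m≤n+m p n))))
                          (trans (splice-< u x i<p) (u≈z i z≤n i<p))
    ... | no  i≮p = trans (sym (splice-≥ x w (≮⇒≥ i≮p))) (xw≈z i (≮⇒≥ i≮p) i<m)
  avoidsFixing-dense (suc r) u a =
    let b , b⊂a , avoid-false , avoid-true =
          dense-∩ (avoidsFixing-hereditary r _) (avoidsFixing-dense r (u [ r ≔ false ])) (avoidsFixing-dense r (u [ r ≔ true ])) a
        avoid-fixing : ∀ v → AvoidsFixing r (u [ r ≔ v ]) b
        avoid-fixing = λ { false → avoid-false ; true → avoid-true }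
    in b , b⊂a , λ z u≈z → avoid-fixing (z r) z (agreeOn-update u≈z)

Covers : SubsetN → ℕ → ℕ → Set
Covers A a b = ∀ i → a ≤ i → i < b → A i ≡ true

coversᵇ : SubsetN → ℕ → ℕ → Bool
coversᵇ A a zero    = true
coversᵇ A a (suc b) = coversᵇ A a b ∧ ((b <ᵇ a) ∨ A b)

∧-true⇒ : ∀ x {y} → x ∧ y ≡ true → x ≡ true × y ≡ true
∧-true⇒ true y≡true = refl , y≡true

coversᵇ-sound : ∀ A a b → coversᵇ A a b ≡ true → Covers A a b
coversᵇ-sound A a (suc b) covers i a≤i i<b+1 =
  let covers-b , covers-last = ∧-true⇒ (coversᵇ A a b) covers in
  [ coversᵇ-sound A a b covers-b i a≤i
  , (λ { refl → trans (sym (cong (_∨ A i) (≥⇒<ᵇ≡false a≤i))) covers-last })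
  ] (m<1+n⇒m<n∨m≡n i<b+1)

coversᵇ-complete : ∀ A a b → Covers A a b → coversᵇ A a b ≡ true
coversᵇ-complete A a zero    _      = refl
coversᵇ-complete A a (suc b) covers =
  cong₂ _∧_ (coversᵇ-complete A a b (λ i a≤i i<b → covers i a≤i (m<n⇒m<1+n i<b))) covers-last
  where
  covers-last : ((b <ᵇ a) ∨ A b) ≡ true
  covers-last with b <? a
  ... | yes b<a = cong (_∨ A b) (<⇒<ᵇ≡true b<a)
  ... | no  b≮a = trans (cong (_∨ A b) (≥⇒<ᵇ≡false (≮⇒≥ b≮a))) (covers b (≮⇒≥ b≮a) ≤-refl)

-- The radius of the window around i grows linearly in i, so a fixed translate moves all but
-- finitely many points of Window A into A.
Window : SubsetN → SubsetN
Window A i = coversᵇ A ⌊ i /2⌋ (i + i)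

∪-below-true : ∀ A c m → (c ≤ m → A m ≡ true) → (A ∪ₛ below c) m ≡ true
∪-below-true A c m large with m <? c
... | yes m<c = trans (cong (A m ∨_) (<⇒<ᵇ≡true m<c)) (∨-zeroʳ (A m))
... | no  m≮c = cong (_∨ (m <ᵇ c)) (large (≮⇒≥ m≮c))

shift-window-⊆ : ∀ A k → ∃ λ c → shift k (Window A) ⊆ₛ (A ∪ₛ below c)
shift-window-⊆ A (+ j) = suc (j + j) , λ m m∈ → ∪-below-true A _ m λ 2j<m →
  let j≤m = ≤-trans (m≤m+n j j) (<⇒≤ 2j<m)
      j<m∸j = subst (_≤ m ∸ j) (m+n∸n≡m (suc j) j) (∸-monoˡ-≤ j 2j<m)
  in coversᵇ-sound A _ _ (trans (sym (shift+-≥ (Window A) j≤m)) m∈) m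
       (≤-trans (⌊n/2⌋≤n (m ∸ j)) (m∸n≤m m j))
       (subst (_< m ∸ j + (m ∸ j)) (m∸n+n≡m j≤m) (+-monoʳ-< (m ∸ j) j<m∸j))
shift-window-⊆ A -[1+ j ] = suc j , λ m m∈ → ∪-below-true A _ m λ j<m →
  coversᵇ-sound A _ _ m∈ m
    (≤-trans (⌊n/2⌋-mono (+-monoʳ-≤ m j<m)) (≤-reflexive (sym (n≡⌊n+n/2⌋ m))))
    (≤-trans (m<m+n m z<s) (m≤m+n _ _))

window-∈-t : ∀ {I A} → IsIdeal I → I A → t I (Window A)
window-∈-t {A = A} I-ideal A∈ k =
  let c , shifted⊆ = shift-window-⊆ A k
  in subset-mem _ _ shifted⊆ (union-mem _ _ A∈ (finite-mem _ (below-finite c)))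
  where open IsIdeal I-ideal

ContainsNoIntervalFrom : (lo hi : ℕ → ℕ) → ℕ → Family
ContainsNoIntervalFrom lo hi k A = ∀ j → k ≤ j → ¬ Covers A (lo j) (hi j)

containsNoIntervalFrom-nowhereDense : ∀ {lo hi} → (∀ k n → Σ ℕ λ j → k ≤ j × n ≤ lo j) →
                                      ∀ k → NowhereDense (ContainsNoIntervalFrom lo hi k)
containsNoIntervalFrom-nowhereDense {lo} {hi} lo-unbounded k x n =
  let j , k≤j , n≤lo = lo-unbounded k n
  in splice n x (λ _ → true) , n + hi j , (λ i i<n → sym (splice-< x _ i<n)) , m≤m+n n (hi j) ,
     λ z y≈z no-interval → no-interval j k≤j λ i lo≤i i<hi →
       trans (sym (y≈z i (<-≤-trans i<hi (m≤n+m (hi j) n)))) (splice-≥ x _ (≤-trans n≤lo lo≤i))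

_∩ₛ_ : SubsetN → SubsetN → SubsetN
(A ∩ₛ B) n = A n ∧ B n

-- The block [P j, P (j+1)) of the limit keeps N 0, …, N j away whatever precedes it, and
-- limit ∩ Window A agrees with the limit on that block as soon as A covers [⌊P j/2⌋, 2 P (j+1)).
meager-t⇒meager : ∀ {I} → IsIdeal I → Meager (t I) → Meager I
meager-t⇒meager {I} I-ideal (N , N-nd , cover) =
  ContainsNoIntervalFrom lo hi , containsNoIntervalFrom-nowhereDense lo-unbounded , λ A A∈ →
    let k , Nk = cover (limit ∩ₛ Window A)
                       (IsIdeal.subset-mem (t-isIdeal I-ideal) _ _ (λ i → proj₂ ∘ ∧-true⇒ (limit i))
                          (window-∈-t I-ideal A∈))
    in k , λ j k≤j A-covers → chain-R j k k≤j _ (agree-on-block j A-covers) Nk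
  where
  open Fusion (λ j a b → ∀ k → k ≤ j → AvoidsAbove (length a) (N k) b)
              (λ j a → dense-∀≤ (λ _ → avoidsAbove-hereditary)
                                (λ k → avoidsAbove-dense (N-nd k) (length a)) j a)
              [ (λ _ → false) ↾ 0 ]

  P : ℕ → ℕ
  P j = length (chain j)

  lo hi : ℕ → ℕ
  lo j = ⌊ P j /2⌋
  hi j = P (suc j) + P (suc j)

  lo-unbounded : ∀ k n → Σ ℕ λ j → k ≤ j × n ≤ lo j
  lo-unbounded k n = k + (n + n) , m≤m+n k (n + n) ,
    ≤-trans (≤-reflexive (n≡⌊n+n/2⌋ n))
            (⌊n/2⌋-mono (≤-trans (m≤n+m (n + n) k) (length-chain-≥ (k + (n + n)))))

  agree-on-block : ∀ {A} j → Covers A (lo j) (hi j) →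
                   AgreeOn (P j) (P (suc j)) (stem (chain (suc j))) (limit ∩ₛ Window A)
  agree-on-block {A} j A-covers i Pj≤i i<P =
    trans (limit-∈ (suc j) i i<P)
          (trans (sym (∧-identityʳ (limit i))) (cong (limit i ∧_) (sym in-window)))
    where
    in-window : Window A i ≡ true
    in-window = coversᵇ-complete A _ _ λ i′ ⌊i/2⌋≤i′ i′<2i →
      A-covers i′ (≤-trans (⌊n/2⌋-mono Pj≤i) ⌊i/2⌋≤i′) (<-trans i′<2i (+-mono-< i<P i<P))

meager⇒hasBaireProperty : ∀ {M} → Meager M → HasBaireProperty M
meager⇒hasBaireProperty M-meager =
  (λ _ → ⊥) , (λ _ ()) , meager-⊆ (λ { _ (inj₁ (Mx , _)) → Mx ; _ (inj₂ (() , _)) }) M-meager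

proposition3p11 : (I : Family) → IsIdeal I →
    (IsIdeal (t I) × TranslationInvariant (t I)) ×
    (¬ HasBaireProperty I → ¬ HasBaireProperty (t I))
proposition3p11 I I-ideal = (t-isIdeal I-ideal , t-translationInvariant I-ideal) , t-not-baire
  where
  t-not-baire : ¬ HasBaireProperty I → ¬ HasBaireProperty (t I)
  t-not-baire ¬baire-I (U , U-open , Δ-meager) = ¬¬-excluded-middle {A = Σ SubsetN U} λ
    { (yes (x , Ux)) →
        let n , x↾n⊆U = U-open x Ux
        in ideal-not-comeager-in-cylinder (t-isIdeal I-ideal) [ x ↾ n ]
             (meager-⊆ (λ z (z∈ , ¬tz) → inj₂ (x↾n⊆U z z∈ , ¬tz)) Δ-meager)
    ; (no U-empty) →
        ¬baire-I (meager⇒hasBaireProperty (meager-t⇒meager I-ideal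
          (meager-⊆ (λ z tz → inj₁ (tz , λ Uz → U-empty (z , Uz))) Δ-meager)))
    }
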